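{- Let $m>1$ be an integer and let $a$ be an integer with $0<a<\sqrt{m}$. Let $F(x,y)=x^2-3axy+y^2$, let $S_a$ be the set of all fundamental solutions of $F(x,y)=m-a^2$, and let $T_a=\{(a,b,c) : (a,b,c) \text{ or } (b,a,c) \text{ is a minimal triple}\}$. Then $S_a$ and $T_a$ have the same cardinality. Moreover, $$\sum_{a\in\mathbb{Z},\,0<a<\sqrt{m}} \#S_a = 2\,\#\{\text{minimal triples}\} - \#\{\text{improper minimal triples}\}.$$
   Context: An $m$-Markoff triple is a triple $(a,b,c)$ of positive integers with $a^2+b^2+c^2=3abc+m$. A minimal triple is an $m$-Markoff triple $(a,b,c)$ with $a\le b\le c$ and $3ab-c\le 0$; it is improper if its components are not pairwise distinct. For fixed $a$, the form $F(x,y)=x^2-3axy+y^2$ has discriminant $9a^2-4$; its integer solutions $(x,y)$ of $F(x,y)=m-a^2$ are partitioned into equivalence classes, two solutions being equivalent if one is obtained from the other by an automorph of $F$, i.e. by $\pm T^k$ ($k\in\mathbb{Z}$) where $T(x,y)=(3ax-y,x)$. Each class contains a unique fundamental solution (the one with least nonnegative second coordinate, suitably normalized). Concretely, with $V=\sqrt{(m-a^2)/(3a+2)}$ and $U=\sqrt{(m-a^2)(3a+2)}$, an integer solution $(u,v)$ with $v\ge 0$ of $F(u,v)=m-a^2$ is fundamental if and only if one of the following holds: (1) $0<v<V$; (2) $v=0$ and $u=\sqrt{m-a^2}$; (3) $v=V$ and $u=(U+3aV)/2$. -}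

module Defs where

open import Data.Nat as ℕ using (ℕ; zero; suc)
open import Data.Integer as ℤ using (ℤ; +_)
open import Data.Bool using (Bool; T; _∧_; _∨_; if_then_else_)
open import Data.Product using (Σ; _×_; _,_)
open import Relation.Nullary.Decidable using (⌊_⌋)

Triple : Set
Triple = ℕ × ℕ × ℕ

isMarkoff : ℕ → Triple → Bool
isMarkoff m (a , b , c) =
  ⌊ 0 ℕ.<? a ⌋ ∧ ⌊ 0 ℕ.<? b ⌋ ∧ ⌊ 0 ℕ.<? c ⌋ ∧
  ⌊ a ℕ.* a ℕ.+ b ℕ.* b ℕ.+ c ℕ.* c ℕ.≟ 3 ℕ.* a ℕ.* b ℕ.* c ℕ.+ m ⌋

isMinimal : ℕ → Triple → Bool
isMinimal m (a , b , c) =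
  isMarkoff m (a , b , c) ∧ ⌊ a ℕ.≤? b ⌋ ∧ ⌊ b ℕ.≤? c ⌋ ∧ ⌊ 3 ℕ.* a ℕ.* b ℕ.≤? c ⌋

isImproper : ℕ → Triple → Bool
isImproper m (a , b , c) =
  isMinimal m (a , b , c) ∧ (⌊ a ℕ.≟ b ⌋ ∨ ⌊ b ℕ.≟ c ⌋ ∨ ⌊ a ℕ.≟ c ⌋)

isInT : ℕ → ℕ → Triple → Bool
isInT m a (x , b , c) =
  ⌊ x ℕ.≟ a ⌋ ∧ (isMinimal m (x , b , c) ∨ isMinimal m (b , x , c))

-- The set of minimal triples, improper minimal triples, and T_a (as subtypes;
-- Bool-valued predicates make membership proof-irrelevant).
MinimalTriples : ℕ → Set
MinimalTriples m = Σ Triple (λ t → T (isMinimal m t))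

ImproperMinimalTriples : ℕ → Set
ImproperMinimalTriples m = Σ Triple (λ t → T (isImproper m t))

TSet : ℕ → ℕ → Set
TSet m a = Σ Triple (λ t → T (isInT m a t))

F : ℕ → ℤ → ℤ → ℤ
F a x y = x ℤ.* x ℤ.- + 3 ℤ.* + a ℤ.* x ℤ.* y ℤ.+ y ℤ.* y

-- Fundamental solutions of F(u,v) = m - a² (with N = m - a², V = √(N/(3a+2)),
-- U = √(N(3a+2)) ), the real conditions written out in integer arithmetic:
--   v ≥ 0 and F(u,v) = N and one of
--   (1) 0 < v < V          ⇔ 0 < v  and  v²(3a+2) < N
--   (2) v = 0, u = √N      ⇔ v = 0, u ≥ 0 and u² = N
--   (3) v = V, u = (U+3aV)/2 ⇔ v²(3a+2) = N, 2u-3av ≥ 0 and (2u-3av)² = N(3a+2)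
isFundamental : ℕ → ℕ → ℤ × ℤ → Bool
isFundamental m a (u , v) =
  ⌊ + 0 ℤ.≤? v ⌋ ∧ ⌊ F a u v ℤ.≟ N ⌋ ∧ (c1 ∨ c2 ∨ c3)
  where
  N : ℤ
  N = + m ℤ.- + a ℤ.* + a
  k : ℤ
  k = + 3 ℤ.* + a ℤ.+ + 2
  w : ℤ
  w = + 2 ℤ.* u ℤ.- + 3 ℤ.* + a ℤ.* v
  c1 c2 c3 : Bool
  c1 = ⌊ + 0 ℤ.<? v ⌋ ∧ ⌊ v ℤ.* v ℤ.* k ℤ.<? N ⌋
  c2 = ⌊ v ℤ.≟ + 0 ⌋ ∧ ⌊ + 0 ℤ.≤? u ⌋ ∧ ⌊ u ℤ.* u ℤ.≟ N ⌋
  c3 = ⌊ v ℤ.* v ℤ.* k ℤ.≟ N ⌋ ∧ ⌊ + 0 ℤ.≤? w ⌋ ∧ ⌊ w ℤ.* w ℤ.≟ N ℤ.* k ⌋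

FundSol : ℕ → ℕ → Set
FundSol m a = Σ (ℤ × ℤ) (λ p → T (isFundamental m a p))

sumSqrtBelow : ℕ → ℕ → (ℕ → ℕ) → ℕ
sumSqrtBelow m zero    f = 0
sumSqrtBelow m (suc n) f =
  sumSqrtBelow m n f ℕ.+ (if ⌊ suc n ℕ.* suc n ℕ.<? m ⌋ then f (suc n) else 0)

-- Σ_{a ∈ ℤ, 0 < a < √m} f a   (every such a satisfies a ≤ m)
sumOverA : ℕ → (ℕ → ℕ) → ℕ
sumOverA m f = sumSqrtBelow m m f

{-# OPTIONS --safe #-}
-- For fixed a write c = 3ab + d.  The Markoff equation for (a, b, c) becomes
-- a² + Q(b, d) = m with Q(b, d) = b² + 3abd + d², and Q(b, d) = F(3ab + d, b) = F(-b, d).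
-- These two solutions of F = m - a² are equivalent, since (-b, d) = -T⁻¹(3ab + d, b), and the
-- fundamental one is the one with the smaller second coordinate: (3ab + d, b) if b ≤ d,
-- (-b, d) if 0 < d < b, and (b, 0) if d = 0.  Since (a, b, c) ∈ T_a only says a, b ≥ 1,
-- c ≥ 3ab and the Markoff equation, both S_a and T_a are in bijection with the solutions
-- (b, d), b ≥ 1, of a² + Q(b, d) = m.
--
-- For the sum, a triple (x, b, c) lies in T_a for the single value a = x exactly when it or
-- its swap (b, x, c) is minimal, and it is an improper minimal triple exactly when both are
-- (b = c and x = c are impossible because c ≥ 3xb > b).  Inclusion–exclusion then gives
-- Σ_a #T_a + #improper = 2 #minimal; all these triples lie in a finite box, so each count
-- is a finite sum over that box.
module Submission where

open import Defs
open import Data.Nat using (ℕ; _<_; _*_; _∸_)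
open import Data.Fin using (Fin)
open import Data.Product using (Σ; _×_)
open import Function.Bundles using (_↔_)
open import Relation.Binary.PropositionalEquality using (_≡_)

open import Data.Bool using (Bool; true; false; T; _∧_; _∨_; if_then_else_)
open import Data.Bool.Properties using (T-∧; T-∨; T-irrelevant; ∧-zeroʳ; ∧-identityʳ; if-eta)
open import Data.Empty using (⊥-elim)
import Data.Fin as Fin
import Data.Fin.Properties as Fin
open import Data.Nat using (zero; suc; _+_; _≤_; _≟_; _≤?_; _<?_; z≤n; s≤s)
import Data.Nat.Properties as ℕ
open import Data.Nat.Tactic.RingSolver using (solve-∀)
open import Algebra.Properties.CommutativeMonoid.Sum ℕ.+-0-commutativeMonoid
  using (sum-syntax; ∑-distrib-+; ∑-comm; sum-cong-≗; sum-replicate-zero)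
open import Data.Product using (_,_; proj₁; proj₂)
open import Data.Product.Function.NonDependent.Propositional using (_×-⇔_)
open import Data.Sum using (_⊎_; inj₁; inj₂)
open import Data.Sum.Function.Propositional using (_⊎-⇔_; _⊎-↔_)
open import Function using (_∘_)
open import Function.Bundles using (_⇔_; mk⇔; mk↔ₛ′; module Equivalence)
open import Function.Construct.Composition using (_⇔-∘_)
open import Function.Construct.Symmetry using (⇔-sym)
open import Function.Properties.Inverse using (↔-trans; ↔-sym)
open import Relation.Binary.PropositionalEquality
  using (refl; sym; trans; cong; cong₂; subst; subst₂; _≗_; _≢_; module ≡-Reasoning)
open import Relation.Nullary using (¬_; Dec; yes; no; contradiction)
open import Relation.Nullary.Decidable using (⌊_⌋; toWitness; fromWitness)
import Relation.Unary as U

module ℤ where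
  open import Data.Integer public
  open import Data.Integer.Properties public
  open import Data.Integer.Tactic.RingSolver public using (solve-∀)
open ℤ using (ℤ; +_; -[1+_]; +≤+; +<+)

open Equivalence using (to; from)

-- Booleans and finite counting

T⌊⌋⇔ : ∀ {p} {P : Set p} (P? : Dec P) → T ⌊ P? ⌋ ⇔ P
T⌊⌋⇔ _ = mk⇔ toWitness fromWitness

T-∧⇔ : ∀ {p r} {P : Set p} {R : Set r} {x y} → T x ⇔ P → T y ⇔ R → T (x ∧ y) ⇔ (P × R)
T-∧⇔ x⇔P y⇔R = (x⇔P ×-⇔ y⇔R) ⇔-∘ T-∧

T-∨⇔ : ∀ {p r} {P : Set p} {R : Set r} {x y} → T x ⇔ P → T y ⇔ R → T (x ∨ y) ⇔ (P ⊎ R)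
T-∨⇔ x⇔P y⇔R = (x⇔P ⊎-⇔ y⇔R) ⇔-∘ T-∨

T-injective : ∀ {x y} → T x ⇔ T y → x ≡ y
T-injective {false} {false} _   = refl
T-injective {false} {true}  x⇔y = ⊥-elim (from x⇔y _)
T-injective {true}  {false} x⇔y = ⊥-elim (to x⇔y _)
T-injective {true}  {true}  _   = refl

indicator : Bool → ℕ
indicator b = if b then 1 else 0

indicator-∨+∧ : ∀ x y → indicator (x ∨ y) + indicator (x ∧ y) ≡ indicator x + indicator y
indicator-∨+∧ false false = refl
indicator-∨+∧ false true  = refl
indicator-∨+∧ true  false = refl
indicator-∨+∧ true  true  = refl

T↔Fin-indicator : ∀ b → T b ↔ Fin (indicator b)
T↔Fin-indicator true  = mk↔ₛ′ (λ _ → Fin.zero) _ (λ { Fin.zero → refl ; (Fin.suc ()) }) (λ _ → refl)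
T↔Fin-indicator false = mk↔ₛ′ (λ ()) (λ ()) (λ ()) (λ ())

Σ-≡-irrelevant : ∀ {A : Set} {P : A → Set} → U.Irrelevant P →
                 ∀ {x y} {p : P x} {q : P y} → x ≡ y → _≡_ {A = Σ A P} (x , p) (y , q)
Σ-≡-irrelevant irr refl = cong (_ ,_) (irr _ _)

Σ-↔-inverseOn : ∀ {A B : Set} {P : A → Set} {R : B → Set} →
                U.Irrelevant P → U.Irrelevant R → (f : A → B) (g : B → A) →
                (∀ x → P x → R (f x) × g (f x) ≡ x) →
                (∀ y → R y → P (g y) × f (g y) ≡ y) →
                Σ A P ↔ Σ B R
Σ-↔-inverseOn irrP irrR f g gf fg = mk↔ₛ′
  (λ (x , p) → f x , proj₁ (gf x p))
  (λ (y , r) → g y , proj₁ (fg y r))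
  (λ (y , r) → Σ-≡-irrelevant irrR (proj₂ (fg y r)))
  (λ (x , p) → Σ-≡-irrelevant irrP (proj₂ (gf x p)))

Σ-Fin-suc↔ : ∀ {n} {P : Fin (suc n) → Set} →
             Σ (Fin (suc n)) P ↔ (P Fin.zero ⊎ Σ (Fin n) (P ∘ Fin.suc))
Σ-Fin-suc↔ = mk↔ₛ′
  (λ { (Fin.zero , p) → inj₁ p ; (Fin.suc i , p) → inj₂ (i , p) })
  (λ { (inj₁ p) → Fin.zero , p ; (inj₂ (i , p)) → Fin.suc i , p })
  (λ { (inj₁ p) → refl ; (inj₂ (i , p)) → refl })
  (λ { (Fin.zero , p) → refl ; (Fin.suc i , p) → refl })

Σ-Fin↔Fin-∑ : ∀ {n} {P : Fin n → Set} (g : Fin n → ℕ) →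
              (∀ i → P i ↔ Fin (g i)) → Σ (Fin n) P ↔ Fin (∑[ i < n ] g i)
Σ-Fin↔Fin-∑ {zero}  g _ = mk↔ₛ′ (λ { (() , _) }) (λ ()) (λ ()) (λ { (() , _) })
Σ-Fin↔Fin-∑ {suc n} g P↔g = ↔-trans Σ-Fin-suc↔ (↔-trans
  (P↔g Fin.zero ⊎-↔ Σ-Fin↔Fin-∑ (g ∘ Fin.suc) (P↔g ∘ Fin.suc))
  (↔-sym Fin.+↔⊎))

Σ-ℕ↔Σ-Fin : ∀ {B} {P : ℕ → Set} → (∀ x → P x → x < B) → Σ ℕ P ↔ Σ (Fin B) (P ∘ Fin.toℕ)
Σ-ℕ↔Σ-Fin {B} {P} bounded = mk↔ₛ′
  (λ (x , p) → Fin.fromℕ< (bounded x p) , subst P (sym (Fin.toℕ-fromℕ< _)) p)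
  (λ (i , p) → Fin.toℕ i , p)
  (λ (i , p) → transport-Fin (Fin.fromℕ<-toℕ i (bounded _ p)) (Fin.toℕ-fromℕ< _))
  (λ (x , p) → transport-ℕ (Fin.toℕ-fromℕ< (bounded x p)))
  where
  transport-ℕ : ∀ {x y} {p : P x} (e : y ≡ x) → _≡_ {A = Σ ℕ P} (y , subst P (sym e) p) (x , p)
  transport-ℕ refl = refl
  transport-Fin : ∀ {i j} {p : P (Fin.toℕ i)} → j ≡ i → (e : Fin.toℕ j ≡ Fin.toℕ i) →
                  _≡_ {A = Σ (Fin B) (P ∘ Fin.toℕ)} (j , subst P (sym e) p) (i , p)
  transport-Fin refl refl = refl

Σ-ℕ↔Fin-∑ : ∀ {B} {P : ℕ → Set} (g : ℕ → ℕ) → (∀ x → P x → x < B) →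
            (∀ x → P x ↔ Fin (g x)) → Σ ℕ P ↔ Fin (∑[ i < B ] g (Fin.toℕ i))
Σ-ℕ↔Fin-∑ g bounded P↔g =
  ↔-trans (Σ-ℕ↔Σ-Fin bounded) (Σ-Fin↔Fin-∑ (g ∘ Fin.toℕ) (P↔g ∘ Fin.toℕ))

∑³ : ℕ → (Triple → ℕ) → ℕ
∑³ B f = ∑[ i < B ] ∑[ j < B ] ∑[ k < B ] f (Fin.toℕ i , Fin.toℕ j , Fin.toℕ k)

count : ℕ → (Triple → Bool) → ℕ
count B P = ∑³ B (indicator ∘ P)

InBox : ℕ → Triple → Set
InBox B (x , y , z) = x < B × y < B × z < B

Σ↔Fin-count : ∀ B (P : Triple → Bool) → (∀ t → T (P t) → InBox B t) →
              Σ Triple (T ∘ P) ↔ Fin (count B P)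
Σ↔Fin-count B P inBox = ↔-trans uncurry³
  (Σ-ℕ↔Fin-∑ _ (λ _ (_ , _ , p) → proj₁ (inBox _ p)) λ x →
   Σ-ℕ↔Fin-∑ _ (λ _ (_ , p) → proj₁ (proj₂ (inBox _ p))) λ y →
   Σ-ℕ↔Fin-∑ _ (λ _ p → proj₂ (proj₂ (inBox _ p))) λ z →
   T↔Fin-indicator (P (x , y , z)))
  where
  uncurry³ : Σ Triple (T ∘ P) ↔ Σ ℕ λ x → Σ ℕ λ y → Σ ℕ λ z → T (P (x , y , z))
  uncurry³ = mk↔ₛ′ (λ ((x , y , z) , p) → x , y , z , p) (λ (x , y , z , p) → (x , y , z) , p)
                   (λ _ → refl) (λ _ → refl)

∑³-cong : ∀ B {f g : Triple → ℕ} → f ≗ g → ∑³ B f ≡ ∑³ B g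
∑³-cong B f≗g = sum-cong-≗ {B} λ _ → sum-cong-≗ {B} λ _ → sum-cong-≗ {B} λ _ → f≗g _

∑³-zero : ∀ B → ∑³ B (λ _ → 0) ≡ 0
∑³-zero B = trans
  (sum-cong-≗ {B} λ _ → trans (sum-cong-≗ {B} λ _ → sum-replicate-zero B) (sum-replicate-zero B))
  (sum-replicate-zero B)

∑³-distrib-+ : ∀ B (f g : Triple → ℕ) → ∑³ B (λ t → f t + g t) ≡ ∑³ B f + ∑³ B g
∑³-distrib-+ B f g = trans
  (sum-cong-≗ {B} λ _ → trans (sum-cong-≗ {B} λ _ → ∑-distrib-+ {B} _ _) (∑-distrib-+ {B} _ _))
  (∑-distrib-+ {B} _ _)

swap₁₂ : Triple → Triple
swap₁₂ (x , y , z) = y , x , z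

∑³-swap₁₂ : ∀ B (f : Triple → ℕ) → ∑³ B (f ∘ swap₁₂) ≡ ∑³ B f
∑³-swap₁₂ B f = ∑-comm {B} {B} λ i j → ∑[ k < B ] f (Fin.toℕ j , Fin.toℕ i , Fin.toℕ k)

sumSqrtBelow-cong : ∀ m n {f g : ℕ → ℕ} → f ≗ g → sumSqrtBelow m n f ≡ sumSqrtBelow m n g
sumSqrtBelow-cong m zero    f≗g = refl
sumSqrtBelow-cong m (suc n) f≗g =
  cong₂ _+_ (sumSqrtBelow-cong m n f≗g)
            (cong (λ x → if ⌊ suc n * suc n <? m ⌋ then x else 0) (f≗g (suc n)))

sumSqrtBelow-zero : ∀ m n → sumSqrtBelow m n (λ _ → 0) ≡ 0
sumSqrtBelow-zero m zero    = refl
sumSqrtBelow-zero m (suc n) = cong₂ _+_ (sumSqrtBelow-zero m n) (if-eta _)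

sumSqrtBelow-∑³ : ∀ m n B (f : ℕ → Triple → ℕ) →
                  sumSqrtBelow m n (λ a → ∑³ B (f a)) ≡ ∑³ B (λ t → sumSqrtBelow m n (λ a → f a t))
sumSqrtBelow-∑³ m zero    B f = sym (∑³-zero B)
sumSqrtBelow-∑³ m (suc n) B f = trans
  (cong₂ _+_ (sumSqrtBelow-∑³ m n B f) (if-∑³ ⌊ suc n * suc n <? m ⌋))
  (sym (∑³-distrib-+ B (λ t → sumSqrtBelow m n (λ a → f a t))
                        (λ t → if ⌊ suc n * suc n <? m ⌋ then f (suc n) t else 0)))
  where
  if-∑³ : ∀ c → (if c then ∑³ B (f (suc n)) else 0) ≡ ∑³ B (λ t → if c then f (suc n) t else 0)
  if-∑³ true  = refl
  if-∑³ false = sym (∑³-zero B)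

δ-term-≢ : ∀ {x y} c → x ≢ y → (if c then indicator ⌊ x ≟ y ⌋ else 0) ≡ 0
δ-term-≢ {x} {y} c x≢y with x ≟ y
... | yes x≡y = contradiction x≡y x≢y
... | no  _   = if-eta c

δ-term-≡ : ∀ {m y} → y * y < m → (if ⌊ y * y <? m ⌋ then indicator ⌊ y ≟ y ⌋ else 0) ≡ 1
δ-term-≡ {m} {y} yy<m with y * y <? m | y ≟ y
... | yes _    | yes _   = refl
... | yes _    | no  y≢y = contradiction refl y≢y
... | no  yy≮m | _       = contradiction yy<m yy≮m

sumSqrtBelow-δ-below : ∀ m n x → n < x → sumSqrtBelow m n (λ a → indicator ⌊ x ≟ a ⌋) ≡ 0
sumSqrtBelow-δ-below m zero    x _   = refl
sumSqrtBelow-δ-below m (suc n) x n<x = cong₂ _+_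
  (sumSqrtBelow-δ-below m n x (ℕ.<-trans (ℕ.n<1+n n) n<x))
  (δ-term-≢ ⌊ suc n * suc n <? m ⌋ (ℕ.>⇒≢ n<x))

sumSqrtBelow-δ : ∀ m n x → 0 < x → x * x < m → x ≤ n →
                 sumSqrtBelow m n (λ a → indicator ⌊ x ≟ a ⌋) ≡ 1
sumSqrtBelow-δ m zero    x 0<x _    x≤0 = contradiction (ℕ.<-≤-trans 0<x x≤0) λ ()
sumSqrtBelow-δ m (suc n) x 0<x xx<m x≤n with ℕ.m≤n⇒m<n∨m≡n x≤n
... | inj₁ x<n  = cong₂ _+_ (sumSqrtBelow-δ m n x 0<x xx<m (ℕ.≤-pred x<n))
                            (δ-term-≢ ⌊ suc n * suc n <? m ⌋ (ℕ.<⇒≢ x<n))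
... | inj₂ refl = cong₂ _+_ (sumSqrtBelow-δ-below m n x ℕ.≤-refl) (δ-term-≡ xx<m)

sumSqrtBelow-δ-∧ : ∀ m n x q → (T q → 0 < x × x * x < m × x ≤ n) →
                   sumSqrtBelow m n (λ a → indicator (⌊ x ≟ a ⌋ ∧ q)) ≡ indicator q
sumSqrtBelow-δ-∧ m n x false _ =
  trans (sumSqrtBelow-cong m n (λ a → cong indicator (∧-zeroʳ _))) (sumSqrtBelow-zero m n)
sumSqrtBelow-δ-∧ m n x true bounds with bounds _
... | 0<x , xx<m , x≤n =
  trans (sumSqrtBelow-cong m n (λ a → cong indicator (∧-identityʳ _))) (sumSqrtBelow-δ m n x 0<x xx<m x≤n)

-- Minimal triples

Minimal : ℕ → Triple → Set
Minimal m (a , b , c) =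
  (0 < a × 0 < b × 0 < c × a * a + b * b + c * c ≡ 3 * a * b * c + m) × a ≤ b × b ≤ c × 3 * a * b ≤ c

isMinimal⇔ : ∀ m a b c → T (isMinimal m (a , b , c)) ⇔ Minimal m (a , b , c)
isMinimal⇔ m a b c =
  T-∧⇔ (T-∧⇔ (T⌊⌋⇔ (0 <? a)) (T-∧⇔ (T⌊⌋⇔ (0 <? b)) (T-∧⇔ (T⌊⌋⇔ (0 <? c))
         (T⌊⌋⇔ (a * a + b * b + c * c ≟ 3 * a * b * c + m)))))
       (T-∧⇔ (T⌊⌋⇔ (a ≤? b)) (T-∧⇔ (T⌊⌋⇔ (b ≤? c)) (T⌊⌋⇔ (3 * a * b ≤? c))))

MinimalUpToSwap : ℕ → Triple → Set
MinimalUpToSwap m (a , b , c) = 0 < a × 0 < b × 3 * a * b ≤ c × a * a + b * b + c * c ≡ 3 * a * b * c + m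

3ab≡3ba : ∀ a b → 3 * a * b ≡ 3 * b * a
3ab≡3ba = solve-∀

n≤3mn : ∀ {m n} → 0 < m → n ≤ 3 * m * n
n≤3mn {suc m} {n} _ = ℕ.m≤n*m n (3 * suc m)

n<3mn : ∀ {m n} → 0 < m → 0 < n → n < 3 * m * n
n<3mn {suc m} {suc n} _ _ = subst (suc n <_) (sym (expand m n)) (ℕ.m<m+n (suc n) (s≤s z≤n))
  where
  expand : ∀ m n → 3 * suc m * suc n ≡ suc n + (suc n + suc n + 3 * m * suc n)
  expand = solve-∀

markoff-swap : ∀ {m} a b c → a * a + b * b + c * c ≡ 3 * a * b * c + m →
               b * b + a * a + c * c ≡ 3 * b * a * c + m
markoff-swap {m} a b c eq =
  trans (cong (_+ c * c) (ℕ.+-comm (b * b) (a * a))) (trans eq (cong (λ x → x * c + m) (3ab≡3ba a b)))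

minimal⊎swap⇔ : ∀ {m a b c} →
                (Minimal m (a , b , c) ⊎ Minimal m (b , a , c)) ⇔ MinimalUpToSwap m (a , b , c)
minimal⊎swap⇔ {m} {a} {b} {c} = mk⇔ unsort sort
  where
  unsort : Minimal m (a , b , c) ⊎ Minimal m (b , a , c) → MinimalUpToSwap m (a , b , c)
  unsort (inj₁ ((0<a , 0<b , _ , eq) , _ , _ , 3ab≤c)) = 0<a , 0<b , 3ab≤c , eq
  unsort (inj₂ ((0<b , 0<a , _ , eq) , _ , _ , 3ba≤c)) =
    0<a , 0<b , subst (_≤ c) (3ab≡3ba b a) 3ba≤c , markoff-swap b a c eq
  sort : MinimalUpToSwap m (a , b , c) → Minimal m (a , b , c) ⊎ Minimal m (b , a , c)
  sort (0<a , 0<b , 3ab≤c , eq) = by-order (a ≤? b)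
    where
    3ba≤c = subst (_≤ c) (3ab≡3ba a b) 3ab≤c
    b≤c = ℕ.≤-trans (n≤3mn 0<a) 3ab≤c
    a≤c = ℕ.≤-trans (n≤3mn 0<b) 3ba≤c
    0<c = ℕ.<-≤-trans 0<b b≤c
    by-order : Dec (a ≤ b) → Minimal m (a , b , c) ⊎ Minimal m (b , a , c)
    by-order (yes a≤b) = inj₁ ((0<a , 0<b , 0<c , eq) , a≤b , b≤c , 3ab≤c)
    by-order (no  a≰b) =
      inj₂ ((0<b , 0<a , 0<c , markoff-swap a b c eq) , ℕ.<⇒≤ (ℕ.≰⇒> a≰b) , a≤c , 3ba≤c)

isMinimal∨swap⇔ : ∀ m a b c →
                  T (isMinimal m (a , b , c) ∨ isMinimal m (b , a , c)) ⇔ MinimalUpToSwap m (a , b , c)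
isMinimal∨swap⇔ m a b c = minimal⊎swap⇔ ⇔-∘ T-∨⇔ (isMinimal⇔ m a b c) (isMinimal⇔ m b a c)

isInT⇔ : ∀ m a x b c → T (isInT m a (x , b , c)) ⇔ (x ≡ a × MinimalUpToSwap m (x , b , c))
isInT⇔ m a x b c = T-∧⇔ (T⌊⌋⇔ (x ≟ a)) (isMinimal∨swap⇔ m x b c)

minimal⇒b<c : ∀ {m a b c} → Minimal m (a , b , c) → b < c
minimal⇒b<c ((0<a , 0<b , _) , _ , _ , 3ab≤c) = ℕ.<-≤-trans (n<3mn 0<a 0<b) 3ab≤c

improper⇔minimal-both : ∀ {m a b c} →
  (Minimal m (a , b , c) × (a ≡ b ⊎ b ≡ c ⊎ a ≡ c)) ⇔ (Minimal m (a , b , c) × Minimal m (b , a , c))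
improper⇔minimal-both {m} {a} {b} {c} = mk⇔ both improper
  where
  both : Minimal m (a , b , c) × (a ≡ b ⊎ b ≡ c ⊎ a ≡ c) → Minimal m (a , b , c) × Minimal m (b , a , c)
  both (min , inj₁ refl)       = min , min
  both (min , inj₂ (inj₁ b≡c)) = contradiction b≡c (ℕ.<⇒≢ (minimal⇒b<c min))
  both (min , inj₂ (inj₂ a≡c)) =
    contradiction a≡c (ℕ.<⇒≢ (ℕ.≤-<-trans (proj₁ (proj₂ min)) (minimal⇒b<c min)))
  improper : Minimal m (a , b , c) × Minimal m (b , a , c) → Minimal m (a , b , c) × (a ≡ b ⊎ b ≡ c ⊎ a ≡ c)
  improper (min , min′) = min , inj₁ (ℕ.≤-antisym (proj₁ (proj₂ min)) (proj₁ (proj₂ min′)))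

isImproper⇔ : ∀ m a b c → T (isImproper m (a , b , c)) ⇔ (Minimal m (a , b , c) × Minimal m (b , a , c))
isImproper⇔ m a b c = improper⇔minimal-both ⇔-∘
  T-∧⇔ (isMinimal⇔ m a b c) (T-∨⇔ (T⌊⌋⇔ (a ≟ b)) (T-∨⇔ (T⌊⌋⇔ (b ≟ c)) (T⌊⌋⇔ (a ≟ c))))

isImproper≡ : ∀ m t → isImproper m t ≡ isMinimal m t ∧ isMinimal m (swap₁₂ t)
isImproper≡ m (a , b , c) =
  T-injective (⇔-sym (T-∧⇔ (isMinimal⇔ m a b c) (isMinimal⇔ m b a c)) ⇔-∘ isImproper⇔ m a b c)

-- The reduced equation a² + Q(b, d) = m

Q : ℕ → ℕ → ℕ → ℕ
Q a b d = b * b + 3 * a * b * d + d * d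

QSolution : ℕ → ℕ → ℕ × ℕ → Set
QSolution m a (b , d) = 0 < b × a * a + Q a b d ≡ m

QSolution-irrelevant : ∀ {m a} → U.Irrelevant (QSolution m a)
QSolution-irrelevant {x = _ , _} (0<b , eq) (0<b′ , eq′) =
  cong₂ _,_ (ℕ.<-irrelevant 0<b 0<b′) (ℕ.≡-irrelevant eq eq′)

Q-comm : ∀ a b d → Q a b d ≡ Q a d b
Q-comm = expanded
  where
  expanded : ∀ a b d → b * b + 3 * a * b * d + d * d ≡ d * d + 3 * a * d * b + b * b
  expanded = solve-∀

Q-axis : ∀ a b → Q a b 0 ≡ b * b
Q-axis = expanded
  where
  expanded : ∀ a b → b * b + 3 * a * b * 0 + 0 * 0 ≡ b * b
  expanded = solve-∀

Q-monoˡ-≤ : ∀ a {b b′} d → b ≤ b′ → Q a b d ≤ Q a b′ d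
Q-monoˡ-≤ a d b≤b′ =
  ℕ.+-monoˡ-≤ (d * d)
    (ℕ.+-mono-≤ (ℕ.*-mono-≤ b≤b′ b≤b′) (ℕ.*-monoˡ-≤ d (ℕ.*-monoʳ-≤ (3 * a) b≤b′)))

Q-monoʳ-< : ∀ a b {d d′} → d < d′ → Q a b d < Q a b d′
Q-monoʳ-< a b d<d′ =
  ℕ.+-mono-≤-< (ℕ.+-monoʳ-≤ (b * b) (ℕ.*-monoʳ-≤ (3 * a * b) (ℕ.<⇒≤ d<d′))) (ℕ.*-mono-< d<d′ d<d′)

markoff-shift : ∀ {m} a b d → let c = 3 * a * b + d in
  (a * a + b * b + c * c ≡ 3 * a * b * c + m) ⇔ (a * a + Q a b d ≡ m)
markoff-shift {m} a b d = mk⇔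
  (λ eq → ℕ.+-cancelˡ-≡ (3 * a * b * c) _ _ (trans (sym (expand a b d)) eq))
  (λ eq → trans (expand a b d) (cong (_+_ (3 * a * b * c)) eq))
  where
  c = 3 * a * b + d
  expand : ∀ a b d → a * a + b * b + (3 * a * b + d) * (3 * a * b + d)
                   ≡ 3 * a * b * (3 * a * b + d) + (a * a + (b * b + 3 * a * b * d + d * d))
  expand = solve-∀

markoff-unshift : ∀ {m a b c} → 3 * a * b ≤ c → a * a + b * b + c * c ≡ 3 * a * b * c + m →
                  a * a + Q a b (c ∸ 3 * a * b) ≡ m
markoff-unshift {m} {a} {b} 3ab≤c eq = to (markoff-shift a b _)
  (subst (λ c → a * a + b * b + c * c ≡ 3 * a * b * c + m) (sym (ℕ.m+[n∸m]≡n 3ab≤c)) eq)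

upToSwap⇔QSolution : ∀ {m a b d} → 0 < a →
                     MinimalUpToSwap m (a , b , 3 * a * b + d) ⇔ QSolution m a (b , d)
upToSwap⇔QSolution {a = a} {b} {d} 0<a = mk⇔
  (λ (_ , 0<b , _ , eq) → 0<b , to (markoff-shift a b d) eq)
  (λ (0<b , eq) → 0<a , 0<b , ℕ.m≤m+n _ d , from (markoff-shift a b d) eq)

n≤n*n : ∀ n → n ≤ n * n
n≤n*n zero    = z≤n
n≤n*n (suc n) = ℕ.m≤m*n (suc n) (suc n)

QSolution-bounds : ∀ {m a b d} → QSolution m a (b , d) → a * a < m × b ≤ m × d ≤ m
QSolution-bounds {m} {a} {b} {d} (0<b , eq) =
  subst (a * a <_) eq (ℕ.m<m+n (a * a) (ℕ.<-≤-trans (ℕ.*-mono-< 0<b 0<b) bb≤Q)) ,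
  ℕ.≤-trans (n≤n*n b) (ℕ.≤-trans bb≤Q Q≤m) ,
  ℕ.≤-trans (n≤n*n d) (ℕ.≤-trans (ℕ.m≤n+m (d * d) _) Q≤m)
  where
  bb≤Q : b * b ≤ Q a b d
  bb≤Q = ℕ.≤-trans (ℕ.m≤m+n (b * b) _) (ℕ.m≤m+n _ (d * d))
  Q≤m : Q a b d ≤ m
  Q≤m = subst (Q a b d ≤_) eq (ℕ.m≤n+m _ (a * a))

box : ℕ → ℕ
box m = suc (3 * m * m + m)

upToSwap-bounds : ∀ {m x b c} → MinimalUpToSwap m (x , b , c) →
                  x * x < m × x ≤ m × InBox (box m) (x , b , c)
upToSwap-bounds {m} {x} {b} {c} (_ , 0<b , 3xb≤c , eq)
  with QSolution-bounds {m} {x} {b} (0<b , markoff-unshift {m} {x} {b} {c} 3xb≤c eq)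
... | xx<m , b≤m , d≤m =
  xx<m , x≤m , s≤s (ℕ.≤-trans x≤m m≤3mm+m) , s≤s (ℕ.≤-trans b≤m m≤3mm+m) , s≤s c≤3mm+m
  where
  x≤m = ℕ.≤-trans (n≤n*n x) (ℕ.<⇒≤ xx<m)
  m≤3mm+m = ℕ.m≤n+m m (3 * m * m)
  c≤3mm+m : c ≤ 3 * m * m + m
  c≤3mm+m = subst (_≤ 3 * m * m + m) (ℕ.m+[n∸m]≡n 3xb≤c)
    (ℕ.+-mono-≤ (ℕ.*-mono-≤ (ℕ.*-monoʳ-≤ 3 x≤m) b≤m) d≤m)

-- Fundamental solutions

N : ℕ → ℕ → ℤ
N m a = + m ℤ.- + a ℤ.* + a

K : ℕ → ℤ
K a = + 3 ℤ.* + a ℤ.+ + 2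

W : ℕ → ℤ → ℤ → ℤ
W a u v = + 2 ℤ.* u ℤ.- + 3 ℤ.* + a ℤ.* v

Interior OnAxis OnBoundary Region Fundamental : ℕ → ℕ → ℤ × ℤ → Set
Interior   m a (u , v) = + 0 ℤ.< v × v ℤ.* v ℤ.* K a ℤ.< N m a
OnAxis     m a (u , v) = v ≡ + 0 × + 0 ℤ.≤ u × u ℤ.* u ≡ N m a
OnBoundary m a (u , v) =
  v ℤ.* v ℤ.* K a ≡ N m a × + 0 ℤ.≤ W a u v × W a u v ℤ.* W a u v ≡ N m a ℤ.* K a
Region     m a p       = Interior m a p ⊎ OnAxis m a p ⊎ OnBoundary m a p
Fundamental m a (u , v) = + 0 ℤ.≤ v × F a u v ≡ N m a × Region m a (u , v)

isFundamental⇔ : ∀ m a p → T (isFundamental m a p) ⇔ Fundamental m a p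
isFundamental⇔ m a (u , v) =
  T-∧⇔ (T⌊⌋⇔ (+ 0 ℤ.≤? v)) (T-∧⇔ (T⌊⌋⇔ (F a u v ℤ.≟ N m a))
    (T-∨⇔ (T-∧⇔ (T⌊⌋⇔ (+ 0 ℤ.<? v)) (T⌊⌋⇔ (v ℤ.* v ℤ.* K a ℤ.<? N m a)))
    (T-∨⇔ (T-∧⇔ (T⌊⌋⇔ (v ℤ.≟ + 0)) (T-∧⇔ (T⌊⌋⇔ (+ 0 ℤ.≤? u)) (T⌊⌋⇔ (u ℤ.* u ℤ.≟ N m a))))
          (T-∧⇔ (T⌊⌋⇔ (v ℤ.* v ℤ.* K a ℤ.≟ N m a)) (T-∧⇔ (T⌊⌋⇔ (+ 0 ℤ.≤? W a u v))
                (T⌊⌋⇔ (W a u v ℤ.* W a u v ℤ.≟ N m a ℤ.* K a)))))))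

pos-*³ : ∀ x y z → + (x * y * z) ≡ + x ℤ.* + y ℤ.* + z
pos-*³ x y z = trans (ℤ.pos-* (x * y) z) (cong (ℤ._* + z) (ℤ.pos-* x y))

pos-3xyz : ∀ x y z → + (3 * x * y * z) ≡ + 3 ℤ.* + x ℤ.* + y ℤ.* + z
pos-3xyz x y z = trans (ℤ.pos-* (3 * x * y) z) (cong (ℤ._* + z) (pos-*³ 3 x y))

pos-3xy+z : ∀ x y z → + (3 * x * y + z) ≡ + 3 ℤ.* + x ℤ.* + y ℤ.+ + z
pos-3xy+z x y z = trans (ℤ.pos-+ (3 * x * y) z) (cong (ℤ._+ + z) (pos-*³ 3 x y))

pos-Q : ∀ a b d → + Q a b d ≡ + b ℤ.* + b ℤ.+ + 3 ℤ.* + a ℤ.* + b ℤ.* + d ℤ.+ + d ℤ.* + d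
pos-Q a b d = trans (ℤ.pos-+ (b * b + 3 * a * b * d) (d * d)) (cong₂ ℤ._+_
  (trans (ℤ.pos-+ (b * b) (3 * a * b * d)) (cong₂ ℤ._+_ (ℤ.pos-* b b) (pos-3xyz a b d)))
  (ℤ.pos-* d d))

pos-a²+ : ∀ a x → + (a * a + x) ≡ + a ℤ.* + a ℤ.+ + x
pos-a²+ a x = trans (ℤ.pos-+ (a * a) x) (cong (ℤ._+ + x) (ℤ.pos-* a a))

-- The shift y lets this apply to F(c, b), which is a natural number only after adding 3abc.
≡N⇔ : ∀ {m a x y} {E : ℤ} → E ℤ.+ + y ≡ + x → (E ≡ N m a) ⇔ (a * a + x ≡ y + m)
≡N⇔ {m} {a} {x} {y} {E} E+y≡x = mk⇔
  (λ E≡N → ℤ.+-injective (begin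
    + (a * a + x)          ≡⟨ pos-a²+ a x ⟩
    A² ℤ.+ + x             ≡⟨ cong (ℤ._+_ A²) (sym E+y≡x) ⟩
    A² ℤ.+ (E ℤ.+ + y)     ≡⟨ cong (λ e → A² ℤ.+ (e ℤ.+ + y)) E≡N ⟩
    A² ℤ.+ (N m a ℤ.+ + y) ≡⟨ cancel A² (+ m) (+ y) ⟩
    + y ℤ.+ + m            ≡⟨ ℤ.pos-+ y m ⟨
    + (y + m)              ∎))
  (λ a²+x≡y+m → begin
    E                                   ≡⟨ uncancel A² E (+ y) ⟩
    A² ℤ.+ (E ℤ.+ + y) ℤ.- (+ y ℤ.+ A²) ≡⟨ cong (λ e → A² ℤ.+ e ℤ.- (+ y ℤ.+ A²)) E+y≡x ⟩
    A² ℤ.+ + x ℤ.- (+ y ℤ.+ A²)         ≡⟨ cong (ℤ._- (+ y ℤ.+ A²)) (begin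
      A² ℤ.+ + x                          ≡⟨ pos-a²+ a x ⟨
      + (a * a + x)                       ≡⟨ cong +_ a²+x≡y+m ⟩
      + (y + m)                           ≡⟨ ℤ.pos-+ y m ⟩
      + y ℤ.+ + m                         ∎) ⟩
    + y ℤ.+ + m ℤ.- (+ y ℤ.+ A²)        ≡⟨ cancel′ (+ y) (+ m) A² ⟩
    N m a                               ∎)
  where
  open ≡-Reasoning
  A² = + a ℤ.* + a
  cancel : ∀ z n w → z ℤ.+ (n ℤ.- z ℤ.+ w) ≡ w ℤ.+ n
  cancel = ℤ.solve-∀
  uncancel : ∀ z e w → e ≡ z ℤ.+ (e ℤ.+ w) ℤ.- (w ℤ.+ z)
  uncancel = ℤ.solve-∀
  cancel′ : ∀ w n z → w ℤ.+ n ℤ.- (w ℤ.+ z) ≡ n ℤ.- z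
  cancel′ = ℤ.solve-∀

≡N⇔₀ : ∀ {m a x} {E : ℤ} → E ≡ + x → (E ≡ N m a) ⇔ (a * a + x ≡ m)
≡N⇔₀ {m} {a} {E = E} E≡x = ≡N⇔ {m} {a} (trans (ℤ.+-identityʳ E) E≡x)

<N⇔ : ∀ {m a x} {E : ℤ} → E ≡ + x → (E ℤ.< N m a) ⇔ (a * a + x < m)
<N⇔ {m} {a} {x} refl = mk⇔
  (λ x<N → ℤ.drop‿+<+ (subst₂ ℤ._<_ (sym (pos-a²+ a x)) (cancel A² (+ m)) (ℤ.+-monoʳ-< A² x<N)))
  (λ a²+x<m → subst (ℤ._< N m a) (uncancel A² (+ x))
     (ℤ.+-monoˡ-< (ℤ.- A²) (subst (ℤ._< + m) (pos-a²+ a x) (+<+ a²+x<m))))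
  where
  A² = + a ℤ.* + a
  cancel : ∀ z n → z ℤ.+ (n ℤ.- z) ≡ n
  cancel = ℤ.solve-∀
  uncancel : ∀ z e → z ℤ.+ e ℤ.- z ≡ e
  uncancel = ℤ.solve-∀

F≡N⇔markoff : ∀ m a b c → (F a (+ c) (+ b) ≡ N m a) ⇔ (a * a + b * b + c * c ≡ 3 * a * b * c + m)
F≡N⇔markoff m a b c = mk⇔
  (λ F≡N → trans (ℕ.+-assoc (a * a) (b * b) (c * c)) (to (≡N⇔ {m} {a} F+3abc) F≡N))
  (λ eq → from (≡N⇔ {m} {a} F+3abc) (trans (sym (ℕ.+-assoc (a * a) (b * b) (c * c))) eq))
  where
  open ≡-Reasoning
  identity : ∀ A B C → C ℤ.* C ℤ.- + 3 ℤ.* A ℤ.* C ℤ.* B ℤ.+ B ℤ.* B ℤ.+ + 3 ℤ.* A ℤ.* B ℤ.* C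
                     ≡ B ℤ.* B ℤ.+ C ℤ.* C
  identity = ℤ.solve-∀
  F+3abc : F a (+ c) (+ b) ℤ.+ + (3 * a * b * c) ≡ + (b * b + c * c)
  F+3abc = begin
    F a (+ c) (+ b) ℤ.+ + (3 * a * b * c)            ≡⟨ cong (ℤ._+_ (F a (+ c) (+ b))) (pos-3xyz a b c) ⟩
    F a (+ c) (+ b) ℤ.+ + 3 ℤ.* + a ℤ.* + b ℤ.* + c  ≡⟨ identity (+ a) (+ b) (+ c) ⟩
    + b ℤ.* + b ℤ.+ + c ℤ.* + c                      ≡⟨ cong₂ ℤ._+_ (ℤ.pos-* b b) (ℤ.pos-* c c) ⟨
    + (b * b) ℤ.+ + (c * c)                          ≡⟨ ℤ.pos-+ (b * b) (c * c) ⟨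
    + (b * b + c * c)                                ∎

F-axis : ∀ a u → F a u (+ 0) ≡ u ℤ.* u
F-axis a u = identity (+ a) u
  where
  identity : ∀ A u → u ℤ.* u ℤ.- + 3 ℤ.* A ℤ.* u ℤ.* + 0 ℤ.+ + 0 ℤ.* + 0 ≡ u ℤ.* u
  identity = ℤ.solve-∀

F-neg : ∀ a b d → F a (ℤ.- + b) (+ d) ≡ + Q a b d
F-neg a b d = trans (identity (+ a) (+ b) (+ d)) (sym (pos-Q a b d))
  where
  identity : ∀ A B D → ℤ.- B ℤ.* ℤ.- B ℤ.- + 3 ℤ.* A ℤ.* ℤ.- B ℤ.* D ℤ.+ D ℤ.* D
                     ≡ B ℤ.* B ℤ.+ + 3 ℤ.* A ℤ.* B ℤ.* D ℤ.+ D ℤ.* D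
  identity = ℤ.solve-∀

square-axis : ∀ a b → + b ℤ.* + b ≡ + Q a b 0
square-axis a b = trans (identity (+ a) (+ b)) (sym (pos-Q a b 0))
  where
  identity : ∀ A B → B ℤ.* B ≡ B ℤ.* B ℤ.+ + 3 ℤ.* A ℤ.* B ℤ.* + 0 ℤ.+ + 0 ℤ.* + 0
  identity = ℤ.solve-∀

square-K : ∀ a n → + n ℤ.* + n ℤ.* K a ≡ + Q a n n
square-K a n = trans (identity (+ a) (+ n)) (sym (pos-Q a n n))
  where
  identity : ∀ A B → B ℤ.* B ℤ.* (+ 3 ℤ.* A ℤ.+ + 2)
                   ≡ B ℤ.* B ℤ.+ + 3 ℤ.* A ℤ.* B ℤ.* B ℤ.+ B ℤ.* B
  identity = ℤ.solve-∀

W-diagonal : ∀ a b → W a (+ (3 * a * b + b)) (+ b) ≡ + b ℤ.* K a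
W-diagonal a b = trans (cong (λ u → W a u (+ b)) (pos-3xy+z a b b)) (identity (+ a) (+ b))
  where
  identity : ∀ A B → + 2 ℤ.* (+ 3 ℤ.* A ℤ.* B ℤ.+ B) ℤ.- + 3 ℤ.* A ℤ.* B
                   ≡ B ℤ.* (+ 3 ℤ.* A ℤ.+ + 2)
  identity = ℤ.solve-∀

bK-nonneg : ∀ a b → + 0 ℤ.≤ + b ℤ.* K a
bK-nonneg a b = subst (+ 0 ℤ.≤_) (trans (ℤ.pos-* b (3 * a + 2)) (cong (+ b ℤ.*_) K≡)) (+≤+ z≤n)
  where
  K≡ : + (3 * a + 2) ≡ K a
  K≡ = trans (ℤ.pos-+ (3 * a) 2) (cong (ℤ._+ + 2) (ℤ.pos-* 3 a))

W-negative : ∀ a k n → ¬ (+ 0 ℤ.≤ W a -[1+ k ] (+ n))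
W-negative a k n 0≤W = negative (subst (+ 0 ℤ.≤_) W≡ 0≤W)
  where
  negative : ∀ {j} → ¬ (+ 0 ℤ.≤ -[1+ j ])
  negative ()
  identity : ∀ A S V → + 2 ℤ.* ℤ.- S ℤ.- + 3 ℤ.* A ℤ.* V ≡ ℤ.- (S ℤ.+ S ℤ.+ + 3 ℤ.* A ℤ.* V)
  identity = ℤ.solve-∀
  W≡ : W a -[1+ k ] (+ n) ≡ ℤ.- + (suc k + suc k + 3 * a * n)
  W≡ = trans (identity (+ a) (+ suc k) (+ n))
    (cong ℤ.-_ (sym (trans (ℤ.pos-+ (suc k + suc k) (3 * a * n))
      (cong₂ ℤ._+_ (ℤ.pos-+ (suc k) (suc k)) (pos-*³ 3 a n)))))

0≢N : ∀ {m a} → a * a < m → ¬ (+ 0 ≡ N m a)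
0≢N {m} {a} a²<m 0≡N =
  ℕ.<⇒≢ a²<m (trans (sym (ℕ.+-identityʳ (a * a))) (to (≡N⇔₀ {m} {a} refl) 0≡N))

fundamentalOf : ℕ → ℕ × ℕ → ℤ × ℤ
fundamentalOf a (b , zero) = + b , + 0
fundamentalOf a (b , suc d) with b ≤? suc d
... | yes _ = + (3 * a * b + suc d) , + b
... | no  _ = ℤ.- + b , + suc d

reducedOf : ℕ → ℤ × ℤ → ℕ × ℕ
reducedOf a (+ k      , + zero)   = k , 0
reducedOf a (+ k      , + suc n)  = suc n , k ∸ 3 * a * suc n
reducedOf a (-[1+ k ] , + d)      = suc k , d
reducedOf a (_        , -[1+ _ ]) = 0 , 0   -- junk: v < 0 is never fundamental

fundamentalOf-≤ : ∀ a {b d} → 0 < b → b ≤ d → fundamentalOf a (b , d) ≡ (+ (3 * a * b + d) , + b)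
fundamentalOf-≤ a {b} {zero}  0<b b≤0 = contradiction (ℕ.<-≤-trans 0<b b≤0) λ ()
fundamentalOf-≤ a {b} {suc d} _   b≤d with b ≤? suc d
... | yes _   = refl
... | no  b≰d = contradiction b≤d b≰d

fundamentalOf-> : ∀ a {b d} → 0 < d → d < b → fundamentalOf a (b , d) ≡ (ℤ.- + b , + d)
fundamentalOf-> a {b} {suc d} _ d<b with b ≤? suc d
... | yes b≤d = contradiction b≤d (ℕ.<⇒≱ d<b)
... | no  _   = refl

interior-above : ∀ {m a b d} → QSolution m a (b , d) → b < d → Interior m a (+ (3 * a * b + d) , + b)
interior-above {m} {a} {b} (0<b , eq) b<d =
  +<+ 0<b , from (<N⇔ {m} {a} (square-K a b))
                 (subst (a * a + Q a b b <_) eq (ℕ.+-monoʳ-< (a * a) (Q-monoʳ-< a b b<d)))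

onBoundary-diagonal : ∀ {m a b} → QSolution m a (b , b) → OnBoundary m a (+ (3 * a * b + b) , + b)
onBoundary-diagonal {m} {a} {b} (_ , eq) =
  bbK≡N , subst (+ 0 ℤ.≤_) (sym (W-diagonal a b)) (bK-nonneg a b) , (begin
    W a (+ (3 * a * b + b)) (+ b) ℤ.* W a (+ (3 * a * b + b)) (+ b) ≡⟨ cong (λ w → w ℤ.* w) (W-diagonal a b) ⟩
    + b ℤ.* K a ℤ.* (+ b ℤ.* K a)                                   ≡⟨ regroup (+ b) (K a) ⟩
    + b ℤ.* + b ℤ.* K a ℤ.* K a                                     ≡⟨ cong (ℤ._* K a) bbK≡N ⟩
    N m a ℤ.* K a                                                   ∎)
  where
  open ≡-Reasoning
  bbK≡N = from (≡N⇔₀ {m} {a} (square-K a b)) eq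
  regroup : ∀ B K → B ℤ.* K ℤ.* (B ℤ.* K) ≡ B ℤ.* B ℤ.* K ℤ.* K
  regroup = ℤ.solve-∀

region-above : ∀ {m a b d} → QSolution m a (b , d) → b ≤ d → Region m a (+ (3 * a * b + d) , + b)
region-above {m} {a} sol b≤d with ℕ.m≤n⇒m<n∨m≡n b≤d
... | inj₁ b<d  = inj₁ (interior-above {m} {a} sol b<d)
... | inj₂ refl = inj₂ (inj₂ (onBoundary-diagonal {m} {a} sol))

fundamental-above : ∀ {m a b d} → QSolution m a (b , d) → b ≤ d → Fundamental m a (+ (3 * a * b + d) , + b)
fundamental-above {m} {a} {b} {d} sol b≤d =
  +≤+ z≤n , from (F≡N⇔markoff m a b (3 * a * b + d)) (from (markoff-shift a b d) (proj₂ sol)) ,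
  region-above {m} {a} sol b≤d

fundamental-below : ∀ {m a b d} → QSolution m a (b , d) → 0 < d → d < b → Fundamental m a (ℤ.- + b , + d)
fundamental-below {m} {a} {b} {d} (_ , eq) 0<d d<b =
  +≤+ z≤n , from (≡N⇔₀ {m} {a} (F-neg a b d)) eq ,
  inj₁ (+<+ 0<d , from (<N⇔ {m} {a} (square-K a d)) (begin-strict
    a * a + Q a d d  <⟨ ℕ.+-monoʳ-< (a * a) (Q-monoʳ-< a d d<b) ⟩
    a * a + Q a d b  ≡⟨ cong (_+_ (a * a)) (Q-comm a d b) ⟩
    a * a + Q a b d  ≡⟨ eq ⟩
    m                ∎))
  where open ℕ.≤-Reasoning

fundamental-axis : ∀ {m a b} → QSolution m a (b , 0) → Fundamental m a (+ b , + 0)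
fundamental-axis {m} {a} {b} (_ , eq) =
  +≤+ z≤n , trans (F-axis a (+ b)) bb≡N , inj₂ (inj₁ (refl , +≤+ z≤n , bb≡N))
  where
  bb≡N = from (≡N⇔₀ {m} {a} (square-axis a b)) eq

fundamentalOf-correct : ∀ {m a} y → QSolution m a y →
                        Fundamental m a (fundamentalOf a y) × reducedOf a (fundamentalOf a y) ≡ y
fundamentalOf-correct (zero , _) (() , _)
fundamentalOf-correct {m} {a} (suc b , zero) sol = fundamental-axis {m} {a} sol , refl
fundamentalOf-correct {m} {a} (suc b , d@(suc _)) sol with ℕ.≤-<-connex (suc b) d
... | inj₁ b≤d rewrite fundamentalOf-≤ a (s≤s z≤n) b≤d =
  fundamental-above {m} {a} sol b≤d , cong (suc b ,_) (ℕ.m+n∸m≡n (3 * a * suc b) d)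
... | inj₂ d<b rewrite fundamentalOf-> a (s≤s z≤n) d<b =
  fundamental-below {m} {a} sol (s≤s z≤n) d<b , refl

markoff⇒3ab≤c : ∀ {m a b c} → 0 < b → a * a + Q a b b ≤ m →
                a * a + b * b + c * c ≡ 3 * a * b * c + m → 3 * a * b ≤ c
markoff⇒3ab≤c {m} {a} {b} {c} 0<b diagonal≤m eq = ℕ.≮⇒≥ λ c<3ab → ℕ.<-irrefl refl (begin-strict
  m                ≤⟨ m≤a²+b² c<3ab ⟩
  a * a + b * b    ≡⟨ cong (_+_ (a * a)) (Q-axis a b) ⟨
  a * a + Q a b 0  <⟨ ℕ.+-monoʳ-< (a * a) (Q-monoʳ-< a b 0<b) ⟩
  a * a + Q a b b  ≤⟨ diagonal≤m ⟩
  m                ∎)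
  where
  open ℕ.≤-Reasoning
  m≤a²+b² : c < 3 * a * b → m ≤ a * a + b * b
  m≤a²+b² c<3ab = ℕ.+-cancelˡ-≤ (3 * a * b * c) m (a * a + b * b) (begin
    3 * a * b * c + m              ≡⟨ eq ⟨
    a * a + b * b + c * c          ≤⟨ ℕ.+-monoʳ-≤ (a * a + b * b) (ℕ.*-monoˡ-≤ c (ℕ.<⇒≤ c<3ab)) ⟩
    a * a + b * b + 3 * a * b * c  ≡⟨ ℕ.+-comm (a * a + b * b) _ ⟩
    3 * a * b * c + (a * a + b * b) ∎)

reduced-above : ∀ {m a k b} → 0 < b → F a (+ k) (+ b) ≡ N m a → a * a + Q a b b ≤ m →
                QSolution m a (b , k ∸ 3 * a * b) × fundamentalOf a (b , k ∸ 3 * a * b) ≡ (+ k , + b)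
reduced-above {m} {a} {k} {b} 0<b F≡N diagonal≤m =
  (0<b , eq) , trans (fundamentalOf-≤ a 0<b b≤d) (cong (λ c → + c , + b) (ℕ.m+[n∸m]≡n 3ab≤k))
  where
  open ℕ.≤-Reasoning
  markoff = to (F≡N⇔markoff m a b k) F≡N
  3ab≤k = markoff⇒3ab≤c {m} {a} {b} {k} 0<b diagonal≤m markoff
  eq = markoff-unshift {m} {a} {b} {k} 3ab≤k markoff
  b≤d = ℕ.≮⇒≥ λ d<b → ℕ.<-irrefl refl (begin-strict
    m                                ≡⟨ eq ⟨
    a * a + Q a b (k ∸ 3 * a * b)    <⟨ ℕ.+-monoʳ-< (a * a) (Q-monoʳ-< a b d<b) ⟩
    a * a + Q a b b                  ≤⟨ diagonal≤m ⟩
    m                                ∎)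

reduced-below : ∀ {m a k d} → 0 < d → F a -[1+ k ] (+ d) ≡ N m a → a * a + Q a d d < m →
                QSolution m a (suc k , d) × fundamentalOf a (suc k , d) ≡ (-[1+ k ] , + d)
reduced-below {m} {a} {k} {d} 0<d F≡N diagonal<m = (s≤s z≤n , eq) , fundamentalOf-> a 0<d d<b
  where
  open ℕ.≤-Reasoning
  eq = to (≡N⇔₀ {m} {a} (F-neg a (suc k) d)) F≡N
  d<b = ℕ.≰⇒> λ b≤d → ℕ.<-irrefl refl (begin-strict
    m                    ≡⟨ eq ⟨
    a * a + Q a (suc k) d ≤⟨ ℕ.+-monoʳ-≤ (a * a) (Q-monoˡ-≤ a d b≤d) ⟩
    a * a + Q a d d      <⟨ diagonal<m ⟩
    m                    ∎)

reducedOf-correct : ∀ {m a} → a * a < m → ∀ p → Fundamental m a p →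
                    QSolution m a (reducedOf a p) × fundamentalOf a (reducedOf a p) ≡ p
reducedOf-correct _ (_ , -[1+ _ ]) (() , _)
reducedOf-correct _ (_ , + zero) (_ , _ , inj₁ (+<+ () , _))
reducedOf-correct {m} {a} a²<m (_ , + zero) (_ , _ , inj₂ (inj₂ (0≡N , _))) =
  contradiction 0≡N (0≢N {m} {a} a²<m)
reducedOf-correct _ (-[1+ _ ] , + zero) (_ , _ , inj₂ (inj₁ (_ , () , _)))
reducedOf-correct {m} {a} a²<m (+ zero , + zero) (_ , _ , inj₂ (inj₁ (_ , _ , 0≡N))) =
  contradiction 0≡N (0≢N {m} {a} a²<m)
reducedOf-correct {m} {a} _ (+ suc k , + zero) (_ , _ , inj₂ (inj₁ (_ , _ , kk≡N))) =
  (s≤s z≤n , to (≡N⇔₀ {m} {a} (square-axis a (suc k))) kk≡N) , refl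
reducedOf-correct _ (_ , + suc n) (_ , _ , inj₂ (inj₁ (() , _)))
reducedOf-correct {m} {a} _ (+ k , + suc n) (_ , F≡N , inj₁ (_ , nnK<N)) =
  reduced-above {m} {a} (s≤s z≤n) F≡N (ℕ.<⇒≤ (to (<N⇔ {m} {a} (square-K a (suc n))) nnK<N))
reducedOf-correct {m} {a} _ (+ k , + suc n) (_ , F≡N , inj₂ (inj₂ (nnK≡N , _))) =
  reduced-above {m} {a} (s≤s z≤n) F≡N (ℕ.≤-reflexive (to (≡N⇔₀ {m} {a} (square-K a (suc n))) nnK≡N))
reducedOf-correct {m} {a} _ (-[1+ k ] , + suc n) (_ , F≡N , inj₁ (_ , nnK<N)) =
  reduced-below {m} {a} (s≤s z≤n) F≡N (to (<N⇔ {m} {a} (square-K a (suc n))) nnK<N)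
reducedOf-correct {a = a} _ (-[1+ k ] , + suc n) (_ , _ , inj₂ (inj₂ (_ , 0≤W , _))) =
  contradiction 0≤W (W-negative a k (suc n))

FundSol↔QSolutions : ∀ {m a} → a * a < m → FundSol m a ↔ Σ (ℕ × ℕ) (QSolution m a)
FundSol↔QSolutions {m} {a} a²<m =
  Σ-↔-inverseOn T-irrelevant (QSolution-irrelevant {m} {a}) (reducedOf a) (fundamentalOf a)
    (λ p fund → reducedOf-correct {m} {a} a²<m p (to (isFundamental⇔ m a p) fund))
    (λ y sol → let (fund , eq) = fundamentalOf-correct {m} {a} y sol
               in from (isFundamental⇔ m a _) fund , eq)

QSolutions↔TSet : ∀ {m a} → 0 < a → Σ (ℕ × ℕ) (QSolution m a) ↔ TSet m a
QSolutions↔TSet {m} {a} 0<a =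
  Σ-↔-inverseOn (QSolution-irrelevant {m} {a}) T-irrelevant
    (λ (b , d) → a , b , 3 * a * b + d) (λ (_ , b , c) → b , c ∸ 3 * a * b)
    (λ (b , d) sol → from (isInT⇔ m a a b _) (refl , from (upToSwap⇔QSolution 0<a) sol) ,
                     cong (b ,_) (ℕ.m+n∸m≡n (3 * a * b) d))
    (λ (x , b , c) inT → unshift x b c (to (isInT⇔ m a x b c) inT))
  where
  unshift : ∀ x b c → x ≡ a × MinimalUpToSwap m (x , b , c) →
            QSolution m a (b , c ∸ 3 * a * b) × (a , b , 3 * a * b + (c ∸ 3 * a * b)) ≡ (x , b , c)
  unshift x b c (refl , _ , 0<b , 3ab≤c , eq) =
    (0<b , markoff-unshift {m} {a} {b} {c} 3ab≤c eq) , cong (λ c′ → a , b , c′) (ℕ.m+[n∸m]≡n 3ab≤c)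

-- Double counting

minimal-inBox : ∀ m t → T (isMinimal m t) → InBox (box m) t
minimal-inBox m (a , b , c) min =
  proj₂ (proj₂ (upToSwap-bounds (to (isMinimal∨swap⇔ m a b c) (from T-∨ (inj₁ min)))))

improper-inBox : ∀ m t → T (isImproper m t) → InBox (box m) t
improper-inBox m t imp = minimal-inBox m t (proj₁ (to T-∧ imp))

inT-inBox : ∀ m a t → T (isInT m a t) → InBox (box m) t
inT-inBox m a (x , b , c) inT = proj₂ (proj₂ (upToSwap-bounds (proj₂ (to (isInT⇔ m a x b c) inT))))

double-count-at : ∀ m t → sumOverA m (λ a → indicator (isInT m a t)) + indicator (isImproper m t)
                        ≡ indicator (isMinimal m t) + indicator (isMinimal m (swap₁₂ t))
double-count-at m t@(x , b , c) = begin
  sumOverA m (λ a → indicator (isInT m a t)) + indicator (isImproper m t)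
    ≡⟨ cong₂ _+_ (sumSqrtBelow-δ-∧ m m x (L ∨ R) bounds) (cong indicator (isImproper≡ m t)) ⟩
  indicator (L ∨ R) + indicator (L ∧ R)
    ≡⟨ indicator-∨+∧ L R ⟩
  indicator L + indicator R ∎
  where
  open ≡-Reasoning
  L = isMinimal m (x , b , c)
  R = isMinimal m (b , x , c)
  bounds : T (L ∨ R) → 0 < x × x * x < m × x ≤ m
  bounds L∨R = let upToSwap = to (isMinimal∨swap⇔ m x b c) L∨R
                   (xx<m , x≤m , _) = upToSwap-bounds upToSwap
               in proj₁ upToSwap , xx<m , x≤m

double-counting : ∀ m B → sumOverA m (λ a → count B (isInT m a)) + count B (isImproper m)
                        ≡ count B (isMinimal m) + count B (isMinimal m)
double-counting m B = begin
  sumOverA m (λ a → count B (isInT m a)) + count B (isImproper m)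
    ≡⟨ cong (_+ count B (isImproper m)) (sumSqrtBelow-∑³ m m B (λ a → indicator ∘ isInT m a)) ⟩
  ∑³ B (λ t → sumOverA m (λ a → indicator (isInT m a t))) + count B (isImproper m)
    ≡⟨ ∑³-distrib-+ B (λ t → sumOverA m (λ a → indicator (isInT m a t))) (indicator ∘ isImproper m) ⟨
  ∑³ B (λ t → sumOverA m (λ a → indicator (isInT m a t)) + indicator (isImproper m t))
    ≡⟨ ∑³-cong B (double-count-at m) ⟩
  ∑³ B (λ t → indicator (isMinimal m t) + indicator (isMinimal m (swap₁₂ t)))
    ≡⟨ ∑³-distrib-+ B (indicator ∘ isMinimal m) (indicator ∘ isMinimal m ∘ swap₁₂) ⟩
  count B (isMinimal m) + ∑³ B (indicator ∘ isMinimal m ∘ swap₁₂)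
    ≡⟨ cong (_+_ (count B (isMinimal m))) (∑³-swap₁₂ B (indicator ∘ isMinimal m)) ⟩
  count B (isMinimal m) + count B (isMinimal m) ∎
  where open ≡-Reasoning

theorem1p2 : (m : ℕ) → 1 < m →
    ((a : ℕ) → 0 < a → a * a < m → FundSol m a ↔ TSet m a)
    × Σ (ℕ → ℕ) (λ s → Σ ℕ (λ M → Σ ℕ (λ I →
        ((a : ℕ) → 0 < a → a * a < m → FundSol m a ↔ Fin (s a))
        × (MinimalTriples m ↔ Fin M)
        × (ImproperMinimalTriples m ↔ Fin I)
        × (sumOverA m s ≡ 2 * M ∸ I))))
theorem1p2 m _ =
  S↔T , s , M , I , S↔Fin ,
  Σ↔Fin-count B (isMinimal m) (minimal-inBox m) , Σ↔Fin-count B (isImproper m) (improper-inBox m) ,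
  sum-identity
  where
  open ≡-Reasoning
  B = box m
  s : ℕ → ℕ
  s a = count B (isInT m a)
  M I : ℕ
  M = count B (isMinimal m)
  I = count B (isImproper m)
  S↔T : (a : ℕ) → 0 < a → a * a < m → FundSol m a ↔ TSet m a
  S↔T a 0<a a²<m = ↔-trans (FundSol↔QSolutions {m} {a} a²<m) (QSolutions↔TSet {m} {a} 0<a)
  S↔Fin : (a : ℕ) → 0 < a → a * a < m → FundSol m a ↔ Fin (s a)
  S↔Fin a 0<a a²<m = ↔-trans (S↔T a 0<a a²<m) (Σ↔Fin-count B (isInT m a) (inT-inBox m a))
  sum-identity : sumOverA m s ≡ 2 * M ∸ I
  sum-identity = begin
    sumOverA m s          ≡⟨ ℕ.m+n∸n≡m (sumOverA m s) I ⟨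
    sumOverA m s + I ∸ I  ≡⟨ cong (_∸ I) (double-counting m B) ⟩
    M + M ∸ I             ≡⟨ cong (λ n → M + n ∸ I) (ℕ.+-identityʳ M) ⟨
    2 * M ∸ I             ∎
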